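{- Let $n\ge1$ and $k\ge1$. (i) There exist $k$ pairwise distinct primes $p_1,\dots,p_k$ such that for $q=p_1\cdots p_k$ we have $\mathrm{DI}(\mathbf{DISJ}_n,q)=\lceil n/k\rceil$. (ii) For every $q$ that is a product of $k$ pairwise distinct primes, $\mathrm{DI}(\mathbf{DISJ}_n,q)\ge n/k$.
   Context: For a predicate $P:\mathcal X\times\mathcal Y\to\{0,1\}$ (finite sets) and integer $q\ge2$, an inner product encoding of $P$ modulo $q$ of length $\ell$ is a pair of maps $x\mapsto \vec x\in\mathbb Z_q^\ell$, $y\mapsto\vec y\in\mathbb Z_q^\ell$ such that for all $x,y$: $P(x,y)=1$ iff $\sum_{i=1}^\ell\vec x_i\vec y_i\equiv0\pmod q$; $\mathrm{DI}(P,q)$ is the minimum such $\ell$. The disjointness predicate $\mathbf{DISJ}_n:2^{[n]}\times2^{[n]}\to\{0,1\}$ is $\mathbf{DISJ}_n(S,T)=1$ iff $S\cap T=\varnothing$. -}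

module Defs where

open import Data.Bool using (Bool; true; false; not)
open import Data.Nat using (ℕ; zero; suc; _+_; _*_; _∸_; _<_; NonZero)
open import Data.Nat.DivMod using (_/_)
open import Data.Nat.Divisibility using (_∣_)
open import Data.Fin using (Fin; toℕ)
open import Data.Fin.Subset using (Subset; _∩_)
open import Data.Fin.Subset.Properties using (nonempty?)
open import Data.Vec.Functional using (Vector; foldr)
open import Data.Product using (Σ; _×_)
open import Function.Bundles using (_⇔_)
open import Relation.Binary.PropositionalEquality using (_≡_)
open import Relation.Nullary using (¬_; does)

-- Inner product of two vectors of length ℓ over Z_q,
-- computed in ℕ on the canonical representatives (reduction mod q is irrelevant
-- since we only test divisibility by q).
innerProd : ∀ {q ℓ} → Vector (Fin q) ℓ → Vector (Fin q) ℓ → ℕ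
innerProd {ℓ = zero}  u v = 0
innerProd {ℓ = suc ℓ} u v =
  toℕ (u Fin.zero) * toℕ (v Fin.zero) + innerProd (λ i → u (Fin.suc i)) (λ i → v (Fin.suc i))

record IPEncoding {X Y : Set} (P : X → Y → Bool) (q ℓ : ℕ) : Set where
  field
    encX : X → Vector (Fin q) ℓ
    encY : Y → Vector (Fin q) ℓ
    correct : ∀ x y → (P x y ≡ true) ⇔ (q ∣ innerProd (encX x) (encY y))

IsDI : {X Y : Set} (P : X → Y → Bool) (q d : ℕ) → Set
IsDI P q d = IPEncoding P q d × (∀ ℓ → ℓ < d → ¬ IPEncoding P q ℓ)

DISJ : (n : ℕ) → Subset n → Subset n → Bool
DISJ n S T = not (does (nonempty? (S ∩ T)))

prod : ∀ {k} → Vector ℕ k → ℕ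
prod = foldr _*_ 1

ceilDiv : (n k : ℕ) → .{{NonZero k}} → ℕ
ceilDiv n k = (n + k ∸ 1) / k

{-# OPTIONS --safe #-}
module Submission where

-- Lower bound: given an encoding modulo q = p₁⋯p_k of length ℓ, let u_i, v_i encode the
-- singletons {i}.  For i ≠ j the product ⟨u_i, v_j⟩ vanishes mod q while ⟨u_i, v_i⟩ does not, so
-- (the p_j being distinct primes) some p_j does not divide ⟨u_i, v_i⟩.  The indices sharing the
-- prime p_j form a biorthogonal system over 𝔽_{p_j}, so there are at most ℓ of them (Gaussian
-- elimination), and n ≤ k ℓ.
--
-- Upper bound: take distinct primes p_j > d = ⌈n/k⌉ and place [n] injectively in a d × k grid.
-- Coordinate b of the encoding of S is Σ_j [(b, j) ∈ S] · q/p_j.  Modulo p_j only column j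
-- survives, and the inner product becomes (q/p_j)² times the number of rows b with (b, j) in
-- both sets, a number < p_j.  So q divides it exactly when the sets are disjoint.

open import Defs
open import Data.Bool using (Bool; true; false; T; not; if_then_else_; _∧_)
open import Data.Bool.Properties using (T-∧)
open import Data.Empty using (⊥; ⊥-elim)
open import Data.Fin using
  ( Fin; zero; suc; toℕ; punchIn; punchOut; inject≤; combine; remQuot) renaming (_≟_ to _≟ᶠ_)
open import Data.Fin.Properties using
  ( any?; suc-injective; toℕ-fromℕ<; punchInᵢ≢i; punchIn-punchOut; punchIn-injective;
    inject≤-injective; combine-remQuot)
open import Data.Fin.Subset using (Subset; _∈_; _∩_; ⁅_⁆)
open import Data.Fin.Subset.Properties using (_∈?_; nonempty?; x∈p∩q⁺; x∈p∩q⁻; x∈⁅x⁆; x∈⁅y⁆⇒x≡y)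
open import Data.List.Base using ([]; _∷_)
open import Data.List.Relation.Unary.All using ([]; _∷_)
open import Data.Nat using
  ( ℕ; zero; suc; pred; _+_; _*_; _∸_; _/_; _%_; _!; _≤_; _<_; _<?_; z≤n; s≤s; s≤s⁻¹; NonZero;
    nonTrivial⇒≢1; >-nonZero⁻¹)
open import Data.Nat.Coprimality using (Coprime; coprime-divisor)
open import Data.Nat.DivMod using
  ( _mod_; m≡m%n+[m/n]*n; m%n<n; m<n*o⇒m/o<n; m∣n⇒o%n%m≡o%m; %-distribˡ-+; %-distribˡ-*; %-remove-+ʳ)
open import Data.Nat.Divisibility using
  ( _∣_; _∣?_; divides; ∣-trans; _∣0; 1∣_; ∣1⇒≡1; m∣m*n; ∣m⇒∣m*n; ∣n⇒∣m*n; ∣m∣n⇒∣m+n; ∣m+n∣m⇒∣n;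
    *-monoˡ-∣; m%n≡0⇒n∣m; n∣m⇒m%n≡0; >⇒∤; m≤n⇒m!∣n!)
open import Data.Nat.Primality using (Prime; euclidsLemma; prime⇒irreducible; prime⇒nonTrivial; prime⇒nonZero)
open import Data.Nat.Primality.Factorisation using (factorise)
open import Data.Nat.Properties using
  ( +-*-semiring; *-1-commutativeMonoid; module ≤-Reasoning; ≤-refl; ≤-reflexive; <-irrefl;
    <-trans; ≤-<-trans; <⇒≢; <⇒≱; ≮⇒≥; 1+n≰n; n<1+n; m≤n⇒m≤1+n; m≤m+n; m≤n⇒m≤o+n; +-comm;
    +-identityʳ; *-comm; *-identityʳ; *-zeroʳ; +-mono-≤; +-monoˡ-≤; +-monoʳ-≤; +-cancelʳ-≤;
    m∸n+n≡m; suc-pred; m*n≢0; 1≤n!)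
open import Data.Nat.Tactic.RingSolver using (solve-∀)
open import Data.Product using (Σ; ∃; _×_; _,_; proj₁; proj₂; uncurry)
open import Data.Product.Properties using (≡-dec)
open import Data.Sum using (inj₁; inj₂; [_,_]′)
open import Data.Vec.Functional as Vector using (Vector; removeAt; tail)
open import Function.Base using (_∘_)
open import Function.Bundles using (_⇔_; mk⇔; Equivalence)
open import Function.Definitions using (Injective)
open import Function.Properties.Equivalence using () renaming (trans to ⇔-trans; sym to ⇔-sym)
open import Relation.Binary.PropositionalEquality using
  ( _≡_; _≢_; refl; sym; trans; cong; cong₂; subst; subst₂; module ≡-Reasoning)
open import Relation.Nullary using (¬_; Dec; does; yes; no; ¬?; _×-dec_)
open import Relation.Nullary.Decidable using (T?; isYes; toWitness; fromWitness; decidable-stable)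

open import Algebra.Properties.Semiring.Sum +-*-semiring
  using (sum; sum-cong-≗; sum-remove; ∑-distrib-+; ∑-comm; *-distribˡ-sum)
open import Algebra.Properties.CommutativeMonoid.Sum *-1-commutativeMonoid
  using () renaming (sum-remove to prod-remove)

-- Finite sums and counting

sum-const : ∀ n c → sum {n} (λ _ → c) ≡ n * c
sum-const zero    c = refl
sum-const (suc n) c = cong (c +_) (sum-const n c)

sum-mono-≤ : ∀ {n} {f g : Vector ℕ n} → (∀ i → f i ≤ g i) → sum f ≤ sum g
sum-mono-≤ {zero}  f≤g = z≤n
sum-mono-≤ {suc n} f≤g = +-mono-≤ (f≤g zero) (sum-mono-≤ (f≤g ∘ suc))

term≤sum : ∀ {n} (f : Vector ℕ n) i → f i ≤ sum f
term≤sum {suc n} f i = subst (f i ≤_) (sym (sum-remove f)) (m≤m+n (f i) _)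

∣sum : ∀ {d n} {f : Vector ℕ n} → (∀ i → d ∣ f i) → d ∣ sum f
∣sum {n = zero}  d∣f = _ ∣0
∣sum {n = suc n} d∣f = ∣m∣n⇒∣m+n (d∣f zero) (∣sum (d∣f ∘ suc))

dot : ∀ {ℓ} → Vector ℕ ℓ → Vector ℕ ℓ → ℕ
dot u v = sum (λ i → u i * v i)

innerProd≡dot : ∀ {q ℓ} (u v : Vector (Fin q) ℓ) → innerProd u v ≡ dot (toℕ ∘ u) (toℕ ∘ v)
innerProd≡dot {ℓ = zero}  u v = refl
innerProd≡dot {ℓ = suc ℓ} u v = cong (toℕ (u zero) * toℕ (v zero) +_) (innerProd≡dot (tail u) (tail v))

dot-linearˡ : ∀ {ℓ} a b (f g v : Vector ℕ ℓ) →
  dot (λ c → a * f c + b * g c) v ≡ a * dot f v + b * dot g v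
dot-linearˡ {ℓ} a b f g v = begin
  dot (λ c → a * f c + b * g c) v
    ≡⟨ sum-cong-≗ (λ c → distrib a b (f c) (g c) (v c)) ⟩
  sum {ℓ} (λ c → a * (f c * v c) + b * (g c * v c))
    ≡⟨ ∑-distrib-+ (λ c → a * (f c * v c)) (λ c → b * (g c * v c)) ⟩
  sum {ℓ} (λ c → a * (f c * v c)) + sum {ℓ} (λ c → b * (g c * v c))
    ≡⟨ sym (cong₂ _+_ (*-distribˡ-sum a (λ c → f c * v c)) (*-distribˡ-sum b (λ c → g c * v c))) ⟩
  a * dot f v + b * dot g v
    ∎
  where
  open ≡-Reasoning
  distrib : ∀ a b x y z → (a * x + b * y) * z ≡ a * (x * z) + b * (y * z)
  distrib = solve-∀

dot-scale : ∀ {ℓ} w (f g : Vector ℕ ℓ) → dot (λ i → f i * w) (λ i → g i * w) ≡ w * w * dot f g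
dot-scale {ℓ} w f g = begin
  dot (λ i → f i * w) (λ i → g i * w)  ≡⟨ sum-cong-≗ (λ i → regroup w (f i) (g i)) ⟩
  sum {ℓ} (λ i → w * w * (f i * g i))  ≡⟨ sym (*-distribˡ-sum (w * w) (λ i → f i * g i)) ⟩
  w * w * dot f g                      ∎
  where
  open ≡-Reasoning
  regroup : ∀ w x y → x * w * (y * w) ≡ w * w * (x * y)
  regroup = solve-∀

indicator : Bool → ℕ
indicator b = if b then 1 else 0

indicator-T : ∀ {b} → T b → indicator b ≡ 1
indicator-T {true} _ = refl

indicator-¬T : ∀ {b} → ¬ T b → indicator b ≡ 0
indicator-¬T {false} _   = refl
indicator-¬T {true}  ¬Tb = ⊥-elim (¬Tb _)

indicator-∧ : ∀ x y → indicator (x ∧ y) ≡ indicator x * indicator y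
indicator-∧ true  y = sym (+-identityʳ (indicator y))
indicator-∧ false y = refl

count : ∀ {m} → (Fin m → Bool) → ℕ
count A = sum (indicator ∘ A)

count≤ : ∀ {m} (A : Fin m → Bool) → count A ≤ m
count≤ {m} A = begin
  count A            ≤⟨ sum-mono-≤ (indicator≤1 ∘ A) ⟩
  sum {m} (λ _ → 1)  ≡⟨ sum-const m 1 ⟩
  m * 1              ≡⟨ *-identityʳ m ⟩
  m                  ∎
  where
  open ≤-Reasoning
  indicator≤1 : ∀ b → indicator b ≤ 1
  indicator≤1 true  = ≤-refl
  indicator≤1 false = z≤n

count≡0 : ∀ {m} {A : Fin m → Bool} → (∀ i → ¬ T (A i)) → count A ≡ 0
count≡0 {m} ¬A = trans (sum-cong-≗ (indicator-¬T ∘ ¬A)) (trans (sum-const m 0) (*-zeroʳ m))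

count≡0⇒¬T : ∀ {m} (A : Fin m → Bool) → count A ≡ 0 → ∀ i → ¬ T (A i)
count≡0⇒¬T A count≡0 i Ai = 1+n≰n (subst₂ _≤_ (indicator-T Ai) count≡0 (term≤sum (indicator ∘ A) i))

count-removeAt : ∀ {m} (A : Fin (suc m) → Bool) {s} → T (A s) → count A ≡ suc (count (removeAt A s))
count-removeAt A {s} As =
  trans (sum-remove {i = s} (indicator ∘ A)) (cong (_+ count (removeAt A s)) (indicator-T As))

cover⇒≤sum-count : ∀ {k n} (A : Fin k → Fin n → Bool) → (∀ i → ∃ λ j → T (A j i)) →
  n ≤ sum (λ j → count (A j))
cover⇒≤sum-count {k} {n} A cover = begin
  n                                          ≡⟨ sym (*-identityʳ n) ⟩
  n * 1                                      ≡⟨ sym (sum-const n 1) ⟩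
  sum {n} (λ _ → 1)                          ≤⟨ sum-mono-≤ one≤ ⟩
  sum (λ i → sum (λ j → indicator (A j i)))  ≡⟨ ∑-comm (λ i j → indicator (A j i)) ⟩
  sum (λ j → count (A j))                    ∎
  where
  open ≤-Reasoning
  one≤ : ∀ i → 1 ≤ sum (λ j → indicator (A j i))
  one≤ i with j , Aji ← cover i = subst (_≤ _) (indicator-T Aji) (term≤sum (λ j → indicator (A j i)) j)

module _ {r : ℕ} .{{_ : NonZero r}} where

  *-cong-% : ∀ a a′ b b′ → a % r ≡ a′ % r → b % r ≡ b′ % r → (a * b) % r ≡ (a′ * b′) % r
  *-cong-% a a′ b b′ a≡a′ b≡b′ = begin
    (a * b) % r              ≡⟨ %-distribˡ-* a b r ⟩
    (a % r * (b % r)) % r    ≡⟨ cong₂ (λ x y → (x * y) % r) a≡a′ b≡b′ ⟩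
    (a′ % r * (b′ % r)) % r  ≡⟨ sym (%-distribˡ-* a′ b′ r) ⟩
    (a′ * b′) % r            ∎
    where open ≡-Reasoning

  sum-cong-% : ∀ {n} (f g : Vector ℕ n) → (∀ i → f i % r ≡ g i % r) → sum f % r ≡ sum g % r
  sum-cong-% {zero}  f g f≡g = refl
  sum-cong-% {suc n} f g f≡g = begin
    (f zero + sum (tail f)) % r          ≡⟨ %-distribˡ-+ (f zero) _ r ⟩
    (f zero % r + sum (tail f) % r) % r  ≡⟨ cong₂ (λ x y → (x + y) % r) (f≡g zero)
                                                  (sum-cong-% (tail f) (tail g) (f≡g ∘ suc)) ⟩
    (g zero % r + sum (tail g) % r) % r  ≡⟨ sym (%-distribˡ-+ (g zero) _ r) ⟩
    (g zero + sum (tail g)) % r          ∎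
    where open ≡-Reasoning

  dot-cong-% : ∀ {n} (f f′ g g′ : Vector ℕ n) → (∀ i → f i % r ≡ f′ i % r) → (∀ i → g i % r ≡ g′ i % r) →
    dot f g % r ≡ dot f′ g′ % r
  dot-cong-% f f′ g g′ f≡f′ g≡g′ =
    sum-cong-% _ _ (λ i → *-cong-% (f i) (f′ i) (g i) (g′ i) (f≡f′ i) (g≡g′ i))

  sum-%≡term-% : ∀ {n} (f : Vector ℕ n) j → (∀ i → i ≢ j → r ∣ f i) → sum f % r ≡ f j % r
  sum-%≡term-% {suc n} f j r∣others = trans (cong (_% r) (sum-remove {i = j} f))
    (%-remove-+ʳ (f j) (∣sum (λ i → r∣others (punchIn j i) (punchInᵢ≢i j i))))

  ∣-respects-% : ∀ {x y} → x % r ≡ y % r → r ∣ x → r ∣ y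
  ∣-respects-% {x} {y} x≡y r∣x = m%n≡0⇒n∣m y r (trans (sym x≡y) (n∣m⇒m%n≡0 x r r∣x))

∣∧<⇒≡0 : ∀ {r n} → r ∣ n → n < r → n ≡ 0
∣∧<⇒≡0 {n = zero}  _   _   = refl
∣∧<⇒≡0 {n = suc n} r∣n n<r = ⊥-elim (>⇒∤ n<r r∣n)

-- Products of distinct primes

prime≢1 : ∀ {r} → Prime r → r ≢ 1
prime≢1 r-prime = nonTrivial⇒≢1 {{prime⇒nonTrivial r-prime}}

prime∣prime⇒≡ : ∀ {r s} → Prime r → Prime s → r ∣ s → r ≡ s
prime∣prime⇒≡ r-prime s-prime r∣s with prime⇒irreducible s-prime r∣s
... | inj₁ r≡1 = ⊥-elim (prime≢1 r-prime r≡1)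
... | inj₂ r≡s = r≡s

prime∤⇒coprime : ∀ {r n} → Prime r → ¬ r ∣ n → Coprime r n
prime∤⇒coprime r-prime r∤n (d∣r , d∣n) with prime⇒irreducible r-prime d∣r
... | inj₁ d≡1  = d≡1
... | inj₂ refl = ⊥-elim (r∤n d∣n)

coprime⇒*∣ : ∀ {m n o} → Coprime m n → m ∣ o → n ∣ o → m * n ∣ o
coprime⇒*∣ {m} {n} coprime m∣o (divides t refl) =
  *-monoˡ-∣ n (coprime-divisor coprime (subst (m ∣_) (*-comm t n) m∣o))

prime∣prod⇒≡ : ∀ {k r} {p : Vector ℕ k} → Prime r → (∀ i → Prime (p i)) → r ∣ prod p → ∃ λ i → r ≡ p i
prime∣prod⇒≡ {zero}          r-prime p-prime r∣1 = ⊥-elim (prime≢1 r-prime (∣1⇒≡1 r∣1))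
prime∣prod⇒≡ {suc k} {p = p} r-prime p-prime r∣prod
  with euclidsLemma (p zero) (prod (tail p)) r-prime r∣prod
... | inj₁ r∣p₀   = zero , prime∣prime⇒≡ r-prime (p-prime zero) r∣p₀
... | inj₂ r∣rest with i , r≡pᵢ ← prime∣prod⇒≡ r-prime (p-prime ∘ suc) r∣rest = suc i , r≡pᵢ

prod-nonZero : ∀ {k} {p : Vector ℕ k} → (∀ i → Prime (p i)) → NonZero (prod p)
prod-nonZero {zero}          p-prime = _
prod-nonZero {suc k} {p = p} p-prime =
  m*n≢0 (p zero) (prod (tail p)) {{prime⇒nonZero (p-prime zero)}} {{prod-nonZero (p-prime ∘ suc)}}

cofactor : ∀ {k} → Vector ℕ k → Fin k → ℕ
cofactor {suc k} p j = prod (removeAt p j)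

prod≡*cofactor : ∀ {k} (p : Vector ℕ k) j → prod p ≡ p j * cofactor p j
prod≡*cofactor {suc k} p j = prod-remove {i = j} p

∣prod : ∀ {k} (p : Vector ℕ k) j → p j ∣ prod p
∣prod p j = subst (p j ∣_) (sym (prod≡*cofactor p j)) (m∣m*n _)

∣cofactor : ∀ {k} (p : Vector ℕ k) {i j} → i ≢ j → p i ∣ cofactor p j
∣cofactor {suc k} p {i} {j} i≢j =
  subst (_∣ cofactor p j) (cong p (punchIn-punchOut j≢i)) (∣prod (removeAt p j) (punchOut j≢i))
  where j≢i = i≢j ∘ sym

∤cofactor : ∀ {k} {p : Vector ℕ k} → Injective _≡_ _≡_ p → (∀ i → Prime (p i)) → ∀ j → ¬ p j ∣ cofactor p j
∤cofactor {suc k} p-injective p-prime j pⱼ∣cofactor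
  with i , pⱼ≡pᵢ ← prime∣prod⇒≡ (p-prime j) (p-prime ∘ punchIn j) pⱼ∣cofactor =
  punchInᵢ≢i j i (sym (p-injective pⱼ≡pᵢ))

prod∣ : ∀ {k x} {p : Vector ℕ k} → Injective _≡_ _≡_ p → (∀ i → Prime (p i)) → (∀ i → p i ∣ x) → prod p ∣ x
prod∣ {zero}  {x} p-injective p-prime p∣x = 1∣ x
prod∣ {suc k}     p-injective p-prime p∣x =
  coprime⇒*∣ (prime∤⇒coprime (p-prime zero) (∤cofactor p-injective p-prime zero))
    (p∣x zero) (prod∣ (suc-injective ∘ p-injective) (p-prime ∘ suc) (p∣x ∘ suc))

∣n! : ∀ {r n} → 1 ≤ r → r ≤ n → r ∣ n !
∣n! {suc r} _ r≤n = ∣-trans (m∣m*n (r !)) (m≤n⇒m!∣n! r≤n)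

-- Euclid: a prime factor of 1 + m! exceeds m.
prime> : ∀ m → ∃ λ r → Prime r × m < r
prime> m with factorise (1 + m !)
... | record { factors = [] ; isFactorisation = 1+m!≡1 } =
  ⊥-elim (<⇒≢ (1≤n! m) (sym (cong pred 1+m!≡1)))
... | record { factors = r ∷ _ ; isFactorisation = 1+m!≡r*rest ; factorsPrime = r-prime ∷ _ } with m <? r
...   | yes m<r = r , r-prime , m<r
...   | no  m≮r = ⊥-elim (prime≢1 r-prime (∣1⇒≡1 (∣m+n∣m⇒∣n r∣m!+1 (∣n! r≥1 (≮⇒≥ m≮r)))))
  where
  r∣m!+1 : r ∣ m ! + 1
  r∣m!+1 = subst (r ∣_) (trans (sym 1+m!≡r*rest) (+-comm 1 (m !))) (m∣m*n _)
  r≥1 : 1 ≤ r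
  r≥1 = >-nonZero⁻¹ r {{prime⇒nonZero r-prime}}

<-∷-injective : ∀ {k r} {p : Vector ℕ k} → (∀ i → r < p i) → Injective _≡_ _≡_ p →
  Injective _≡_ _≡_ (r Vector.∷ p)
<-∷-injective r<p p-injective {zero}  {zero}  _     = refl
<-∷-injective r<p p-injective {zero}  {suc j} r≡pⱼ  = ⊥-elim (<-irrefl r≡pⱼ (r<p j))
<-∷-injective r<p p-injective {suc i} {zero}  pᵢ≡r  = ⊥-elim (<-irrefl (sym pᵢ≡r) (r<p i))
<-∷-injective r<p p-injective {suc i} {suc j} pᵢ≡pⱼ = cong suc (p-injective pᵢ≡pⱼ)

distinctPrimes> : ∀ m k → Σ (Vector ℕ k) λ p → Injective _≡_ _≡_ p × (∀ i → Prime (p i)) × (∀ i → m < p i)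
distinctPrimes> m zero    = (λ ()) , (λ { {()} }) , (λ ()) , (λ ())
distinctPrimes> m (suc k) with r , r-prime , m<r ← prime> m
  with p , p-injective , p-prime , r<p ← distinctPrimes> r k =
  r Vector.∷ p , <-∷-injective r<p p-injective , (λ { zero → r-prime ; (suc i) → p-prime i })
               , (λ { zero → m<r ; (suc i) → <-trans m<r (r<p i) })

-- Biorthogonal families modulo a prime

record Biorthogonal (p : ℕ) {m ℓ} (A : Fin m → Bool) (u v : Fin m → Vector ℕ ℓ) : Set where
  field
    off-diagonal : ∀ {i j} → T (A i) → T (A j) → i ≢ j → p ∣ dot (u i) (v j)
    diagonal     : ∀ {i} → T (A i) → ¬ p ∣ dot (u i) (v i)

biorthogonal-tail : ∀ {p m ℓ} {A : Fin m → Bool} {u v : Fin m → Vector ℕ (suc ℓ)} →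
  Biorthogonal p A u v → (∀ {i} → T (A i) → p ∣ u i zero) → Biorthogonal p A (tail ∘ u) (tail ∘ v)
biorthogonal-tail {v = v} B p∣head = record
  { off-diagonal = λ {i} {j} Ai Aj i≢j →
      ∣m+n∣m⇒∣n (off-diagonal Ai Aj i≢j) (∣m⇒∣m*n (v j zero) (p∣head Ai))
  ; diagonal     = λ {i} Ai p∣tail →
      diagonal Ai (∣m∣n⇒∣m+n (∣m⇒∣m*n (v i zero) (p∣head Ai)) p∣tail)
  }
  where open Biorthogonal B

-- Row operation u_i ↦ a · u_i − u_i(0) · u_s with pivot a = u_s(0), where −1 is represented by pred p.
eliminate : ∀ {m ℓ} (p : ℕ) (u : Fin (suc m) → Vector ℕ (suc ℓ)) (s : Fin (suc m)) → Fin m → Vector ℕ (suc ℓ)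
eliminate p u s i c = u s zero * u (punchIn s i) c + pred p * u (punchIn s i) zero * u s c

p∣eliminate-head : ∀ {m ℓ} p .{{_ : NonZero p}} (u : Fin (suc m) → Vector ℕ (suc ℓ)) s i →
  p ∣ eliminate p u s i zero
p∣eliminate-head p u s i = subst (p ∣_) (sym head≡) (m∣m*n _)
  where
  cancel : ∀ q a x → a * x + q * x * a ≡ suc q * (a * x)
  cancel = solve-∀
  head≡ : eliminate p u s i zero ≡ p * (u s zero * u (punchIn s i) zero)
  head≡ = trans (cancel (pred p) (u s zero) (u (punchIn s i) zero)) (cong (_* _) (suc-pred p))

eliminate-biorthogonal : ∀ {p m ℓ} {A : Fin (suc m) → Bool} {u v : Fin (suc m) → Vector ℕ (suc ℓ)} {s} →
  Prime p → Biorthogonal p A u v → T (A s) → ¬ p ∣ u s zero →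
  Biorthogonal p (removeAt A s) (eliminate p u s) (removeAt v s)
eliminate-biorthogonal {p} {A = A} {u} {v} {s} p-prime B As p∤pivot = record
  { off-diagonal = λ {i} {j} Ai Aj i≢j → subst (p ∣_) (sym (expand i j))
      (∣m∣n⇒∣m+n (∣n⇒∣m*n (u s zero) (off-diagonal Ai Aj (i≢j ∘ punchIn-injective s i j)))
                 (∣n⇒∣m*n (multiplier i) (p∣pivot-row Aj)))
  ; diagonal     = λ {i} Ai p∣elim → [ p∤pivot , diagonal Ai ]′ (euclidsLemma (u s zero) _ p-prime
      (∣m+n∣m⇒∣n (subst (p ∣_) (trans (expand i i) (+-comm (u s zero * _) _)) p∣elim)
                 (∣n⇒∣m*n (multiplier i) (p∣pivot-row Ai))))
  }
  where
  open Biorthogonal B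
  multiplier : Fin _ → ℕ
  multiplier i = pred p * u (punchIn s i) zero
  expand : ∀ i j → dot (eliminate p u s i) (removeAt v s j)
                 ≡ u s zero * dot (u (punchIn s i)) (v (punchIn s j)) + multiplier i * dot (u s) (v (punchIn s j))
  expand i j = dot-linearˡ (u s zero) (multiplier i) (u (punchIn s i)) (u s) (v (punchIn s j))
  p∣pivot-row : ∀ {j} → T (A (punchIn s j)) → p ∣ dot (u s) (v (punchIn s j))
  p∣pivot-row {j} Aj = off-diagonal As Aj (punchInᵢ≢i s j ∘ sym)

biorthogonal⇒count≤dim : ∀ {p m ℓ} {A : Fin m → Bool} {u v : Fin m → Vector ℕ ℓ} →
  Prime p → Biorthogonal p A u v → count A ≤ ℓ
biorthogonal⇒count≤dim {p} {ℓ = zero} {A} p-prime B =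
  ≤-reflexive (count≡0 {A = A} (λ i Ai → Biorthogonal.diagonal B Ai (p ∣0)))
biorthogonal⇒count≤dim {m = zero}  {ℓ = suc ℓ} p-prime B = z≤n
biorthogonal⇒count≤dim {p} {suc m} {suc ℓ} {A} {u} p-prime B
  with any? (λ s → T? (A s) ×-dec ¬? (p ∣? u s zero))
... | yes (s , As , p∤pivot) = begin
  count A                     ≡⟨ count-removeAt A As ⟩
  suc (count (removeAt A s))  ≤⟨ s≤s (biorthogonal⇒count≤dim p-prime
                                   (biorthogonal-tail (eliminate-biorthogonal p-prime B As p∤pivot)
                                                      (λ {i} _ → p∣eliminate-head p u s i))) ⟩
  suc ℓ                       ∎
  where
  open ≤-Reasoning
  instance _ = prime⇒nonZero p-prime
... | no no-pivot = m≤n⇒m≤1+n (biorthogonal⇒count≤dim p-prime (biorthogonal-tail B p∣head))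
  where
  p∣head : ∀ {i} → T (A i) → p ∣ u i zero
  p∣head {i} Ai = decidable-stable (p ∣? u i zero) (λ p∤ → no-pivot (i , Ai , p∤))

-- Lower bound

not-does≡true⇔¬ : ∀ {a} {P : Set a} (P? : Dec P) → not (does P?) ≡ true ⇔ (¬ P)
not-does≡true⇔¬ (yes p)  = mk⇔ (λ ()) (λ ¬p → ⊥-elim (¬p p))
not-does≡true⇔¬ (no ¬p) = mk⇔ (λ _ → ¬p) (λ _ → refl)

DISJ≡true⇔ : ∀ {n} (S S′ : Subset n) → DISJ n S S′ ≡ true ⇔ (∀ {x} → x ∈ S → x ∈ S′ → ⊥)
DISJ≡true⇔ {n} S S′ =
  mk⇔ no-common-element (λ h → from (λ (_ , x∈S∩S′) → uncurry h (x∈p∩q⁻ S S′ x∈S∩S′)))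
  where
  open Equivalence (not-does≡true⇔¬ (nonempty? (S ∩ S′)))
  no-common-element : DISJ n S S′ ≡ true → ∀ {x} → x ∈ S → x ∈ S′ → ⊥
  no-common-element disj x∈S x∈S′ = to disj (_ , x∈p∩q⁺ (x∈S , x∈S′))

DISJ-singletons-≢ : ∀ {n} {i j : Fin n} → i ≢ j → DISJ n ⁅ i ⁆ ⁅ j ⁆ ≡ true
DISJ-singletons-≢ {i = i} {j} i≢j = Equivalence.from (DISJ≡true⇔ ⁅ i ⁆ ⁅ j ⁆)
  (λ x∈⁅i⁆ x∈⁅j⁆ → i≢j (trans (sym (x∈⁅y⁆⇒x≡y i x∈⁅i⁆)) (x∈⁅y⁆⇒x≡y j x∈⁅j⁆)))

DISJ-singletons-≡ : ∀ {n} (i : Fin n) → DISJ n ⁅ i ⁆ ⁅ i ⁆ ≢ true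
DISJ-singletons-≡ i disj = Equivalence.to (DISJ≡true⇔ ⁅ i ⁆ ⁅ i ⁆) disj (x∈⁅x⁆ i) (x∈⁅x⁆ i)

encoding⇒n≤k*ℓ : ∀ {n k ℓ} {p : Vector ℕ k} → Injective _≡_ _≡_ p → (∀ j → Prime (p j)) →
  IPEncoding (DISJ n) (prod p) ℓ → n ≤ k * ℓ
encoding⇒n≤k*ℓ {n} {k} {ℓ} {p} p-injective p-prime E = begin
  n                        ≤⟨ cover⇒≤sum-count A covered ⟩
  sum (λ j → count (A j))  ≤⟨ sum-mono-≤ (λ j → biorthogonal⇒count≤dim (p-prime j) (class-biorthogonal j)) ⟩
  sum {k} (λ _ → ℓ)        ≡⟨ sum-const k ℓ ⟩
  k * ℓ                    ∎
  where
  open ≤-Reasoning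
  open IPEncoding E
  u v : Fin n → Vector ℕ ℓ
  u i = toℕ ∘ encX ⁅ i ⁆
  v i = toℕ ∘ encY ⁅ i ⁆
  disjoint⇔prod∣ : ∀ i j → (DISJ n ⁅ i ⁆ ⁅ j ⁆ ≡ true) ⇔ (prod p ∣ dot (u i) (v j))
  disjoint⇔prod∣ i j = subst (λ x → (DISJ n ⁅ i ⁆ ⁅ j ⁆ ≡ true) ⇔ (prod p ∣ x))
                             (innerProd≡dot (encX ⁅ i ⁆) (encY ⁅ j ⁆)) (correct ⁅ i ⁆ ⁅ j ⁆)
  A : Fin k → Fin n → Bool
  A j i = isYes (¬? (p j ∣? dot (u i) (v i)))
  class-biorthogonal : ∀ j → Biorthogonal (p j) (A j) u v
  class-biorthogonal j = record
    { off-diagonal = λ {i} {i′} _ _ i≢i′ →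
        ∣-trans (∣prod p j) (Equivalence.to (disjoint⇔prod∣ i i′) (DISJ-singletons-≢ i≢i′))
    ; diagonal     = toWitness
    }
  covered : ∀ i → ∃ λ j → T (A j i)
  covered i with any? (λ j → ¬? (p j ∣? dot (u i) (v i)))
  ... | yes (j , pⱼ∤) = j , fromWitness pⱼ∤
  ... | no none = ⊥-elim (DISJ-singletons-≡ i (Equivalence.from (disjoint⇔prod∣ i i)
                    (prod∣ p-injective p-prime (λ j → decidable-stable (p j ∣? _) (λ pⱼ∤ → none (j , pⱼ∤))))))

-- Upper bound

module BlockEncoding {k} {p : Vector ℕ k} (p-injective : Injective _≡_ _≡_ p) (p-prime : ∀ j → Prime (p j)) where

  instance
    _ = prod-nonZero p-prime

  encode : ∀ {d} → (Fin d → Fin k → Bool) → Vector (Fin (prod p)) d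
  encode s b = sum (λ j → indicator (s b j) * cofactor p j) mod prod p

  commonBits : ∀ {d} → (Fin d → Fin k → Bool) → (Fin d → Fin k → Bool) → Fin k → ℕ
  commonBits s t j = count (λ b → s b j ∧ t b j)

  module _ {d : ℕ} (j : Fin k) where
    private instance _ = prime⇒nonZero (p-prime j)

    encode-% : ∀ (s : Fin d → Fin k → Bool) b → toℕ (encode s b) % p j ≡ (indicator (s b j) * cofactor p j) % p j
    encode-% s b = begin
      toℕ (encode s b) % p j  ≡⟨ cong (_% p j) (toℕ-fromℕ< _) ⟩
      (x % prod p) % p j      ≡⟨ m∣n⇒o%n%m≡o%m (p j) (prod p) x (∣prod p j) ⟩
      x % p j                 ≡⟨ sum-%≡term-% (λ i → indicator (s b i) * cofactor p i) j
                                   (λ i i≢j → ∣n⇒∣m*n (indicator (s b i)) (∣cofactor p (i≢j ∘ sym))) ⟩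
      (indicator (s b j) * cofactor p j) % p j ∎
      where
      open ≡-Reasoning
      x = sum (λ i → indicator (s b i) * cofactor p i)

    innerProd-encode-% : ∀ s t →
      innerProd (encode {d} s) (encode t) % p j ≡ (cofactor p j * cofactor p j * commonBits s t j) % p j
    innerProd-encode-% s t = begin
      innerProd (encode s) (encode t) % p j
        ≡⟨ cong (_% p j) (innerProd≡dot (encode s) (encode t)) ⟩
      dot (toℕ ∘ encode s) (toℕ ∘ encode t) % p j
        ≡⟨ dot-cong-% (toℕ ∘ encode s) (λ b → indicator (s b j) * w) (toℕ ∘ encode t) (λ b → indicator (t b j) * w)
                      (encode-% s) (encode-% t) ⟩
      dot (λ b → indicator (s b j) * w) (λ b → indicator (t b j) * w) % p j
        ≡⟨ cong (_% p j) (dot-scale w (λ b → indicator (s b j)) (λ b → indicator (t b j))) ⟩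
      (w * w * dot (λ b → indicator (s b j)) (λ b → indicator (t b j))) % p j
        ≡⟨ cong (λ x → (w * w * x) % p j) (sum-cong-≗ (λ b → sym (indicator-∧ (s b j) (t b j)))) ⟩
      (w * w * commonBits s t j) % p j
        ∎
      where
      open ≡-Reasoning
      w = cofactor p j

    p∣innerProd-encode⇒commonBits≡0 : d < p j → ∀ s t → p j ∣ innerProd (encode s) (encode t) → commonBits s t j ≡ 0
    p∣innerProd-encode⇒commonBits≡0 d<pⱼ s t pⱼ∣
      with euclidsLemma (cofactor p j * cofactor p j) _ (p-prime j) (∣-respects-% (innerProd-encode-% s t) pⱼ∣)
    ... | inj₂ pⱼ∣commonBits = ∣∧<⇒≡0 pⱼ∣commonBits (≤-<-trans (count≤ _) d<pⱼ)
    ... | inj₁ pⱼ∣w*w        = ⊥-elim ([ ∤cofactor p-injective p-prime j , ∤cofactor p-injective p-prime j ]′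
                                          (euclidsLemma _ _ (p-prime j) pⱼ∣w*w))

    commonBits≡0⇒p∣innerProd-encode : ∀ s t → commonBits s t j ≡ 0 → p j ∣ innerProd (encode s) (encode t)
    commonBits≡0⇒p∣innerProd-encode s t commonBits≡0 = ∣-respects-% (sym (innerProd-encode-% s t))
      (subst (λ x → p j ∣ w * w * x) (sym commonBits≡0) (∣n⇒∣m*n (w * w) (p j ∣0)))
      where w = cofactor p j

  prod∣innerProd-encode⇔ : ∀ {d} → (∀ j → d < p j) → ∀ s t →
    prod p ∣ innerProd (encode {d} s) (encode t) ⇔ (∀ b j → ¬ T (s b j ∧ t b j))
  prod∣innerProd-encode⇔ d<p s t = mk⇔
    (λ prod∣ b j → count≡0⇒¬T _ (p∣innerProd-encode⇒commonBits≡0 j (d<p j) s t (∣-trans (∣prod p j) prod∣)) b)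
    (λ disjoint → prod∣ p-injective p-prime
                    (λ j → commonBits≡0⇒p∣innerProd-encode j s t (count≡0 (λ b → disjoint b j))))

module _ {n d k : ℕ} (ι : Fin n → Fin d × Fin k) where

  occupied? : ∀ S b j → Dec (∃ λ x → ι x ≡ (b , j) × x ∈ S)
  occupied? S b j = any? (λ x → ≡-dec _≟ᶠ_ _≟ᶠ_ (ι x) (b , j) ×-dec (x ∈? S))

  bits : Subset n → Fin d → Fin k → Bool
  bits S b j = isYes (occupied? S b j)

  DISJ⇔bits-disjoint : Injective _≡_ _≡_ ι → ∀ S S′ →
    DISJ n S S′ ≡ true ⇔ (∀ b j → ¬ T (bits S b j ∧ bits S′ b j))
  DISJ⇔bits-disjoint ι-injective S S′ = mk⇔ bits-disjoint (λ h → from (no-common-element h _))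
    where
    open Equivalence (DISJ≡true⇔ S S′)
    bits-disjoint : DISJ n S S′ ≡ true → ∀ b j → ¬ T (bits S b j ∧ bits S′ b j)
    bits-disjoint disj b j both
      with inS , inS′ ← T-∧ .Equivalence.to both
      with x , ιx≡bj , x∈S ← toWitness {a? = occupied? S b j} inS
      with x′ , ιx′≡bj , x′∈S′ ← toWitness {a? = occupied? S′ b j} inS′ =
      to disj x∈S (subst (_∈ S′) (ι-injective (trans ιx′≡bj (sym ιx≡bj))) x′∈S′)
    no-common-element : (∀ b j → ¬ T (bits S b j ∧ bits S′ b j)) → ∀ x → x ∈ S → x ∈ S′ → ⊥
    no-common-element h x x∈S x∈S′ = h (proj₁ (ι x)) (proj₂ (ι x)) (T-∧ .Equivalence.from
      ( fromWitness {a? = occupied? S _ _} (x , refl , x∈S)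
      , fromWitness {a? = occupied? S′ _ _} (x , refl , x∈S′)))

layout : ∀ {n d k} → n ≤ d * k → Fin n → Fin d × Fin k
layout {k = k} n≤d*k x = remQuot k (inject≤ x n≤d*k)

layout-injective : ∀ {n d k} (n≤d*k : n ≤ d * k) → Injective _≡_ _≡_ (layout {n} {d} {k} n≤d*k)
layout-injective {d = d} {k} n≤d*k {x} {y} e = inject≤-injective n≤d*k n≤d*k x y (begin
  inject≤ x n≤d*k                               ≡⟨ sym (combine-remQuot {d} k (inject≤ x n≤d*k)) ⟩
  uncurry combine (layout {d = d} {k} n≤d*k x)  ≡⟨ cong (uncurry combine) e ⟩
  uncurry combine (layout {d = d} {k} n≤d*k y)  ≡⟨ combine-remQuot {d} k (inject≤ y n≤d*k) ⟩
  inject≤ y n≤d*k                               ∎)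
  where open ≡-Reasoning

DISJ-encoding : ∀ {n d k} {p : Vector ℕ k} → n ≤ d * k → Injective _≡_ _≡_ p → (∀ j → Prime (p j)) →
  (∀ j → d < p j) → IPEncoding (DISJ n) (prod p) d
DISJ-encoding {n} {d} {k} n≤d*k p-injective p-prime d<p = record
  { encX    = encode ∘ bits ι
  ; encY    = encode ∘ bits ι
  ; correct = λ S S′ → ⇔-trans (DISJ⇔bits-disjoint ι (layout-injective n≤d*k) S S′)
                               (⇔-sym (prod∣innerProd-encode⇔ d<p (bits ι S) (bits ι S′)))
  }
  where
  open BlockEncoding p-injective p-prime
  ι = layout {n} {d} {k} n≤d*k

suc[n+k∸1]≡n+k : ∀ n k .{{_ : NonZero k}} → suc (n + k ∸ 1) ≡ n + k
suc[n+k∸1]≡n+k n k = trans (+-comm 1 _) (m∸n+n≡m (m≤n⇒m≤o+n n (>-nonZero⁻¹ k)))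

n≤ceilDiv*k : ∀ n k .{{_ : NonZero k}} → n ≤ ceilDiv n k * k
n≤ceilDiv*k n k = +-cancelʳ-≤ k n (ceilDiv n k * k) (begin
  n + k                    ≡⟨ sym (suc[n+k∸1]≡n+k n k) ⟩
  suc m                    ≡⟨ cong suc (m≡m%n+[m/n]*n m k) ⟩
  suc (m % k + m / k * k)  ≡⟨ +-comm (suc (m % k)) (m / k * k) ⟩
  m / k * k + suc (m % k)  ≤⟨ +-monoʳ-≤ (m / k * k) (m%n<n m k) ⟩
  ceilDiv n k * k + k      ∎)
  where
  open ≤-Reasoning
  m = n + k ∸ 1

ceilDiv-least : ∀ n k .{{_ : NonZero k}} {ℓ} → n ≤ k * ℓ → ceilDiv n k ≤ ℓ
ceilDiv-least n k {ℓ} n≤k*ℓ = s≤s⁻¹ (m<n*o⇒m/o<n (begin-strict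
  n + k ∸ 1        <⟨ n<1+n _ ⟩
  suc (n + k ∸ 1)  ≡⟨ suc[n+k∸1]≡n+k n k ⟩
  n + k            ≤⟨ +-monoˡ-≤ k n≤k*ℓ ⟩
  k * ℓ + k        ≡⟨ +-comm (k * ℓ) k ⟩
  k + k * ℓ        ≡⟨ cong (k +_) (*-comm k ℓ) ⟩
  suc ℓ * k        ∎))
  where open ≤-Reasoning

mainTheorem6 : (n k : ℕ) → 1 ≤ n → .{{_ : NonZero k}} →
    (Σ (Fin k → ℕ) λ p → Injective _≡_ _≡_ p × (∀ i → Prime (p i))
        × IsDI (DISJ n) (prod p) (ceilDiv n k))
    × (∀ (p : Fin k → ℕ) → Injective _≡_ _≡_ p → (∀ i → Prime (p i)) →
        ∀ d → IsDI (DISJ n) (prod p) d → n ≤ k * d)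
-- The hypothesis 1 ≤ n is unused: the argument also covers n = 0, where ⌈n/k⌉ = 0.
mainTheorem6 n k _ with p , p-injective , p-prime , d<p ← distinctPrimes> (ceilDiv n k) k =
    (p , p-injective , p-prime , DISJ-encoding (n≤ceilDiv*k n k) p-injective p-prime d<p
       , λ ℓ ℓ<d E → <⇒≱ ℓ<d (ceilDiv-least n k (encoding⇒n≤k*ℓ p-injective p-prime E)))
  , λ p p-injective p-prime d (E , _) → encoding⇒n≤k*ℓ p-injective p-prime E
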